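{- Let $S_n=\sum_{k=0}^n\binom{n}{k}^2\binom{2k}{k}(2k+1)$ for $n\geq 0$. Then the sequence $\{\sqrt[n]{S_n}\}_{n\geq 1}$ is strictly increasing and $\lim_{n\to\infty}\sqrt[n]{S_n}=9$. -}

module Defs where

open import Data.Nat using (ℕ; zero; suc; _+_; _*_)
open import Data.Nat.Combinatorics using (_C_)
open import Data.List using (map; upTo)
open import Data.Nat.ListAction using (sum)
open import Data.Integer using (+_)
open import Data.Rational using (ℚ; 1ℚ; _/_) renaming (_*_ to _*ℚ_)

S : ℕ → ℕ
S n = sum (map (λ k → (n C k) * (n C k) * ((2 * k) C k) * (2 * k + 1)) (upTo (suc n)))

_^ℚ_ : ℚ → ℕ → ℚ
q ^ℚ zero = 1ℚ
q ^ℚ suc n = q *ℚ (q ^ℚ n)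

ℕtoℚ : ℕ → ℚ
ℕtoℚ n = (+ n) / 1

{-# OPTIONS --safe #-}
module Submission where

-- Write w n k = C(n,k)² C(2k,k) and W n = Σₖ w n k, so that S n = Σₖ (2k+1) w n k.
-- Creative telescoping in k gives 3 Sₙ = (4n+3) Wₙ and
-- 9(n+1)² Wₙ + (n+2)² Wₙ₊₂ = (10n²+30n+23) Wₙ₊₁, hence a three-term recurrence for S.
-- Pushing ratio bounds through this recurrence by induction yields
--   9 − 7/(n+1)² ≤ Sₙ₊₁/Sₙ ≤ 9,
-- so that Sₙ₊₁ ≤ 7·9ⁿ and 9ⁿ ≤ (n+1) Sₙ₊₁. Now Sₙ^(n+1) < Sₙ₊₁ⁿ amounts to Sₙ < (Sₙ₊₁/Sₙ)ⁿ,
-- which holds because (9 − 7/(n+1)²)ⁿ > 7·9ⁿ⁻¹ by the mean-value bound (x+7)ⁿ ≤ xⁿ + 7n(x+7)ⁿ⁻¹.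
-- For the limit, Sₙ ≤ 9ⁿ < (9+ε)ⁿ; and if 1/(d+1) ≤ ε then (9−ε)(d+1) ≤ x = 9d+8, while
-- 9n xⁿ < (x+1)ⁿ = 9ⁿ(d+1)ⁿ ≤ 9n Sₙ (d+1)ⁿ as soon as n(n−1)/2 > 9n x², from the
-- quadratic term of the binomial expansion of (x+1)ⁿ.

open import Defs

module Binomial where

  open import Data.Nat
  open import Data.Nat.Properties
  open import Data.Nat.Combinatorics
  open import Data.Nat.Tactic.RingSolver using (solve)
  open import Algebra.Properties.CommutativeSemigroup *-commutativeSemigroup using (x∙yz≈y∙xz)
  open import Data.List.Base using (_∷_; [])
  open import Relation.Binary.PropositionalEquality
  open ≡-Reasoning

  [k+1]*[n+1]C[k+1]≡[n+1]*nCk : ∀ n k → suc k * (suc n C suc k) ≡ suc n * (n C k)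
  [k+1]*[n+1]C[k+1]≡[n+1]*nCk n zero = trans (+-identityʳ _) (trans (nC1≡n (suc n)) (sym (*-identityʳ (suc n))))
  [k+1]*[n+1]C[k+1]≡[n+1]*nCk zero (suc k) = *-zeroʳ (suc (suc k))
  [k+1]*[n+1]C[k+1]≡[n+1]*nCk (suc n) (suc k) = begin
    suc (suc k) * (suc (suc n) C suc (suc k))
      ≡⟨ cong (suc (suc k) *_) (nCk+nC[k+1]≡[n+1]C[k+1] (suc n) (suc k)) ⟨
    suc (suc k) * (a + b)
      ≡⟨ *-distribˡ-+ (suc (suc k)) a b ⟩
    (a + suc k * a) + suc (suc k) * b
      ≡⟨ +-assoc a (suc k * a) _ ⟩
    a + (suc k * a + suc (suc k) * b)
      ≡⟨ cong (a +_) (cong₂ _+_ ([k+1]*[n+1]C[k+1]≡[n+1]*nCk n k) ([k+1]*[n+1]C[k+1]≡[n+1]*nCk n (suc k))) ⟩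
    a + (suc n * (n C k) + suc n * (n C suc k))
      ≡⟨ cong (a +_) (*-distribˡ-+ (suc n) (n C k) (n C suc k)) ⟨
    a + suc n * (n C k + n C suc k)
      ≡⟨ cong (λ x → a + suc n * x) (nCk+nC[k+1]≡[n+1]C[k+1] n k) ⟩
    suc (suc n) * a ∎
    where
      a = suc n C suc k
      b = suc n C suc (suc k)

  [n∸k]*nCk≡[k+1]*nC[k+1] : ∀ n k → (n ∸ k) * (n C k) ≡ suc k * (n C suc k)
  [n∸k]*nCk≡[k+1]*nC[k+1] n k = begin
    (suc n ∸ suc k) * (n C k)
      ≡⟨ *-distribʳ-∸ (n C k) (suc n) (suc k) ⟩
    suc n * (n C k) ∸ suc k * (n C k)
      ≡⟨ cong (_∸ suc k * (n C k)) ([k+1]*[n+1]C[k+1]≡[n+1]*nCk n k) ⟨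
    suc k * (suc n C suc k) ∸ suc k * (n C k)
      ≡⟨ cong (λ x → suc k * x ∸ suc k * (n C k)) (nCk+nC[k+1]≡[n+1]C[k+1] n k) ⟨
    suc k * (n C k + n C suc k) ∸ suc k * (n C k)
      ≡⟨ cong (_∸ suc k * (n C k)) (*-distribˡ-+ (suc k) (n C k) (n C suc k)) ⟩
    suc k * (n C k) + suc k * (n C suc k) ∸ suc k * (n C k)
      ≡⟨ m+n∸m≡n (suc k * (n C k)) _ ⟩
    suc k * (n C suc k) ∎

  [n+1]*nCk≡[n+1∸k]*[n+1]Ck : ∀ n k → suc n * (n C k) ≡ (suc n ∸ k) * (suc n C k)
  [n+1]*nCk≡[n+1∸k]*[n+1]Ck n zero = refl
  [n+1]*nCk≡[n+1∸k]*[n+1]Ck n (suc k) = begin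
    suc n * (n C suc k)
      ≡⟨ cong (suc n *_) (m+n∸m≡n (n C k) (n C suc k)) ⟨
    suc n * (n C k + n C suc k ∸ n C k)
      ≡⟨ *-distribˡ-∸ (suc n) _ (n C k) ⟩
    suc n * (n C k + n C suc k) ∸ suc n * (n C k)
      ≡⟨ cong₂ (λ x y → suc n * x ∸ y) (nCk+nC[k+1]≡[n+1]C[k+1] n k) (sym ([k+1]*[n+1]C[k+1]≡[n+1]*nCk n k)) ⟩
    suc n * (suc n C suc k) ∸ suc k * (suc n C suc k)
      ≡⟨ *-distribʳ-∸ (suc n C suc k) (suc n) (suc k) ⟨
    (n ∸ k) * (suc n C suc k) ∎

  [k+1]*[2k+2]C[k+1]≡2[2k+1]*2kCk : ∀ k → suc k * (2 * suc k C suc k) ≡ 2 * (2 * k + 1) * (2 * k C k)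
  [k+1]*[2k+2]C[k+1]≡2[2k+1]*2kCk k = *-cancelˡ-≡ _ _ (suc k) (begin
    suc k * (suc k * (2 * suc k C suc k))
      ≡⟨ cong (λ m → suc k * (suc k * (m C suc k))) 2[k+1]≡2k+2 ⟩
    suc k * (suc k * (suc (suc (2 * k)) C suc k))
      ≡⟨ cong (suc k *_) ([k+1]*[n+1]C[k+1]≡[n+1]*nCk (suc (2 * k)) k) ⟩
    suc k * (suc (suc (2 * k)) * (suc (2 * k) C k))
      ≡⟨ x∙yz≈y∙xz (suc k) (suc (suc (2 * k))) (suc (2 * k) C k) ⟩
    suc (suc (2 * k)) * (suc k * (suc (2 * k) C k))
      ≡⟨ cong (λ m → suc (suc (2 * k)) * (m * (suc (2 * k) C k))) 2k+1∸k≡k+1 ⟨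
    suc (suc (2 * k)) * ((suc (2 * k) ∸ k) * (suc (2 * k) C k))
      ≡⟨ cong (suc (suc (2 * k)) *_) ([n+1]*nCk≡[n+1∸k]*[n+1]Ck (2 * k) k) ⟨
    suc (suc (2 * k)) * (suc (2 * k) * (2 * k C k))
      ≡⟨ regroup (2 * k C k) ⟩
    suc k * (2 * (2 * k + 1) * (2 * k C k)) ∎)
    where
      2[k+1]≡2k+2 : 2 * suc k ≡ suc (suc (2 * k))
      2[k+1]≡2k+2 = solve (k ∷ [])
      2k+1≡[k+1]+k : suc (2 * k) ≡ suc k + k
      2k+1≡[k+1]+k = solve (k ∷ [])
      2k+1∸k≡k+1 : suc (2 * k) ∸ k ≡ suc k
      2k+1∸k≡k+1 = trans (cong (_∸ k) 2k+1≡[k+1]+k) (m+n∸n≡m (suc k) k)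
      regroup : ∀ c → suc (suc (2 * k)) * (suc (2 * k) * c) ≡ suc k * (2 * (2 * k + 1) * c)
      regroup c = solve (k ∷ c ∷ [])

module FiniteSums where

  open import Data.Nat
  open import Data.Nat.Properties
  open import Data.Nat.ListAction using (sum)
  open import Data.Nat.ListAction.Properties using (sum-++)
  open import Data.List.Base using (map; upTo; _∷ʳ_; [_])
  open import Data.List.Properties using (upTo-∷ʳ; map-++)
  open import Data.Sum.Base using (inj₁; inj₂)
  open import Function.Base using (_∘_)
  open import Algebra.Properties.CommutativeSemigroup +-commutativeSemigroup
    using (interchange; x∙yz≈xz∙y; xy∙z≈xz∙y)
  open import Relation.Binary.PropositionalEquality
    using (_≡_; refl; sym; cong; cong₂; module ≡-Reasoning)
  open ≡-Reasoning

  ∑ : ℕ → (ℕ → ℕ) → ℕ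
  ∑ zero    f = 0
  ∑ (suc m) f = ∑ m f + f m

  sum-map-upTo : ∀ m f → sum (map f (upTo m)) ≡ ∑ m f
  sum-map-upTo zero    f = refl
  sum-map-upTo (suc m) f = begin
    sum (map f (upTo (suc m)))        ≡⟨ cong (sum ∘ map f) (upTo-∷ʳ m) ⟨
    sum (map f (upTo m ∷ʳ m))         ≡⟨ cong sum (map-++ f (upTo m) [ m ]) ⟩
    sum (map f (upTo m) ∷ʳ f m)       ≡⟨ sum-++ (map f (upTo m)) [ f m ] ⟩
    sum (map f (upTo m)) + (f m + 0)  ≡⟨ cong₂ _+_ (sum-map-upTo m f) (+-identityʳ (f m)) ⟩
    ∑ m f + f m                       ∎

  ∑-distrib-+ : ∀ m f g → ∑ m (λ k → f k + g k) ≡ ∑ m f + ∑ m g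
  ∑-distrib-+ zero    f g = refl
  ∑-distrib-+ (suc m) f g = begin
    ∑ m (λ k → f k + g k) + (f m + g m)  ≡⟨ cong (_+ (f m + g m)) (∑-distrib-+ m f g) ⟩
    (∑ m f + ∑ m g) + (f m + g m)        ≡⟨ interchange (∑ m f) (∑ m g) (f m) (g m) ⟩
    ∑ (suc m) f + ∑ (suc m) g            ∎

  *-distribˡ-∑ : ∀ m c f → ∑ m (λ k → c * f k) ≡ c * ∑ m f
  *-distribˡ-∑ zero    c f = sym (*-zeroʳ c)
  *-distribˡ-∑ (suc m) c f = begin
    ∑ m (λ k → c * f k) + c * f m  ≡⟨ cong (_+ c * f m) (*-distribˡ-∑ m c f) ⟩
    c * ∑ m f + c * f m            ≡⟨ *-distribˡ-+ c (∑ m f) (f m) ⟨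
    c * ∑ (suc m) f                ∎

  ∑-linear : ∀ m a b f g → ∑ m (λ k → a * f k + b * g k) ≡ a * ∑ m f + b * ∑ m g
  ∑-linear m a b f g = begin
    ∑ m (λ k → a * f k + b * g k)          ≡⟨ ∑-distrib-+ m (λ k → a * f k) (λ k → b * g k) ⟩
    ∑ m (λ k → a * f k) + ∑ m (λ k → b * g k)  ≡⟨ cong₂ _+_ (*-distribˡ-∑ m a f) (*-distribˡ-∑ m b g) ⟩
    a * ∑ m f + b * ∑ m g                  ∎

  ∑-zero-tail : ∀ {m} m′ f → (∀ k → m ≤ k → f k ≡ 0) → m ≤ m′ → ∑ m′ f ≡ ∑ m f
  ∑-zero-tail {m} m′ f vanish m≤m′ with m≤n⇒m<n∨m≡n m≤m′
  ... | inj₂ refl = refl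
  ∑-zero-tail {m} (suc m′) f vanish m≤m′ | inj₁ m<1+m′ = begin
    ∑ m′ f + f m′  ≡⟨ cong₂ _+_ (∑-zero-tail m′ f vanish (≤-pred m<1+m′)) (vanish m′ (≤-pred m<1+m′)) ⟩
    ∑ m f + 0      ≡⟨ +-identityʳ (∑ m f) ⟩
    ∑ m f          ∎

  ∑-telescope : ∀ m {f g h : ℕ → ℕ} → (∀ k → k < m → f k + h (suc k) ≡ g k + h k) →
                h 0 ≡ 0 → h m ≡ 0 → ∑ m f ≡ ∑ m g
  ∑-telescope m {f} {g} {h} step h0≡0 hm≡0 = +-cancelʳ-≡ 0 (∑ m f) (∑ m g) (begin
    ∑ m f + 0    ≡⟨ cong (∑ m f +_) hm≡0 ⟨
    ∑ m f + h m  ≡⟨ telescope m step ⟩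
    ∑ m g + h 0  ≡⟨ cong (∑ m g +_) h0≡0 ⟩
    ∑ m g + 0    ∎)
    where
      telescope : ∀ m′ → (∀ k → k < m′ → f k + h (suc k) ≡ g k + h k) → ∑ m′ f + h m′ ≡ ∑ m′ g + h 0
      telescope zero     step′ = refl
      telescope (suc m′) step′ = begin
        (∑ m′ f + f m′) + h (suc m′)  ≡⟨ +-assoc (∑ m′ f) (f m′) (h (suc m′)) ⟩
        ∑ m′ f + (f m′ + h (suc m′))  ≡⟨ cong (∑ m′ f +_) (step′ m′ ≤-refl) ⟩
        ∑ m′ f + (g m′ + h m′)        ≡⟨ x∙yz≈xz∙y (∑ m′ f) (g m′) (h m′) ⟩
        (∑ m′ f + h m′) + g m′        ≡⟨ cong (_+ g m′) (telescope m′ (λ k k<m′ → step′ k (m<n⇒m<1+n k<m′))) ⟩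
        (∑ m′ g + h 0) + g m′         ≡⟨ xy∙z≈xz∙y (∑ m′ g) (h 0) (g m′) ⟩
        (∑ m′ g + g m′) + h 0         ∎

module Recurrences where

  open import Data.Nat
  open import Data.Nat.Properties
  open import Data.Nat.Combinatorics using (_C_; nCn≡1; k>n⇒nCk≡0)
  open import Data.Nat.Tactic.RingSolver using (solve)
  open import Data.List.Base using (_∷_; [])
  open import Data.Product.Base using (_,_)
  open import Data.Sum.Base using (inj₁; inj₂)
  open import Relation.Binary.PropositionalEquality
  open ≡-Reasoning
  open Binomial
  open FiniteSums
  open import Algebra.Properties.CommutativeSemigroup *-commutativeSemigroup using (x∙yz≈y∙xz)

  w : ℕ → ℕ → ℕ
  w n k = (n C k) * (n C k) * (2 * k C k)

  W : ℕ → ℕ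
  W n = ∑ (suc n) (w n)

  w-vanishes : ∀ {n k} → n < k → w n k ≡ 0
  w-vanishes {n} {k} n<k = cong (λ x → x * x * (2 * k C k)) (k>n⇒nCk≡0 n<k)

  w-diagonal : ∀ n → w n n ≡ 2 * n C n
  w-diagonal n = trans (cong (λ x → x * x * (2 * n C n)) (nCn≡1 n)) (*-identityˡ (2 * n C n))

  w-diagonal-ratio : ∀ n → suc n * w (suc n) (suc n) ≡ 2 * (2 * n + 1) * w n n
  w-diagonal-ratio n = subst₂ (λ c c₀ → suc n * c ≡ 2 * (2 * n + 1) * c₀) (sym (w-diagonal (suc n))) (sym (w-diagonal n))
    ([k+1]*[2k+2]C[k+1]≡2[2k+1]*2kCk n)

  private
    squared : ∀ a b x y c → a * x ≡ b * y → a * a * (x * x * c) ≡ b * b * (y * y * c)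
    squared a b x y c ax≡by = begin
      a * a * (x * x * c)    ≡⟨ solve (a ∷ x ∷ c ∷ []) ⟩
      (a * x) * (a * x) * c  ≡⟨ cong (λ z → z * z * c) ax≡by ⟩
      (b * y) * (b * y) * c  ≡⟨ solve (b ∷ y ∷ c ∷ []) ⟩
      b * b * (y * y * c)    ∎

  w-ratio-n : ∀ n k → suc n * suc n * w n k ≡ (suc n ∸ k) * (suc n ∸ k) * w (suc n) k
  w-ratio-n n k = squared (suc n) (suc n ∸ k) (n C k) (suc n C k) (2 * k C k) ([n+1]*nCk≡[n+1∸k]*[n+1]Ck n k)

  w-ratio-k : ∀ n k → (n ∸ k) * (n ∸ k) * (2 * (2 * k + 1) * w n k) ≡ suc k * suc k * suc k * w n (suc k)
  w-ratio-k n k = ratio (n ∸ k) (n C k) (n C suc k) (2 * k C k) (2 * suc k C suc k)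
    ([n∸k]*nCk≡[k+1]*nC[k+1] n k) ([k+1]*[2k+2]C[k+1]≡2[2k+1]*2kCk k)
    where
      ratio : ∀ d x y c c′ → d * x ≡ suc k * y → suc k * c′ ≡ 2 * (2 * k + 1) * c →
              d * d * (2 * (2 * k + 1) * (x * x * c)) ≡ suc k * suc k * suc k * (y * y * c′)
      ratio d x y c c′ dx≡[k+1]y [k+1]c′≡2[2k+1]c = begin
        d * d * (2 * (2 * k + 1) * (x * x * c))          ≡⟨ solve (d ∷ k ∷ x ∷ c ∷ []) ⟩
        d * d * (x * x * (2 * (2 * k + 1) * c))          ≡⟨ squared d (suc k) x y _ dx≡[k+1]y ⟩
        suc k * suc k * (y * y * (2 * (2 * k + 1) * c))  ≡⟨ cong (λ z → suc k * suc k * (y * y * z)) [k+1]c′≡2[2k+1]c ⟨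
        suc k * suc k * (y * y * (suc k * c′))           ≡⟨ solve (k ∷ y ∷ c′ ∷ []) ⟩
        suc k * suc k * suc k * (y * y * c′)             ∎

  s : ℕ → ℕ → ℕ
  s n k = w n k * (2 * k + 1)

  -- Creative-telescoping certificates (as found by Zeilberger's algorithm): G relates S to W, H gives the recurrence of W.
  G : ℕ → ℕ → ℕ
  G n zero    = 0
  G n (suc k) = 2 * (2 * k + 1) * w n k

  -- The subtraction only truncates for k > n + 1, where w (suc n) k = 0.
  H : ℕ → ℕ → ℕ
  H n zero    = 0
  H n (suc k) = (4 * n + 5 ∸ 3 * k) * (2 * (2 * k + 1) * w (suc n) k)

  G-vanishes : ∀ {n k} → n < k → G n (suc k) ≡ 0
  G-vanishes {n} {k} n<k = trans (cong (2 * (2 * k + 1) *_) (w-vanishes n<k)) (*-zeroʳ (2 * (2 * k + 1)))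

  H-vanishes : ∀ {n k} → suc n < k → H n (suc k) ≡ 0
  H-vanishes {n} {k} 1+n<k = begin
    (4 * n + 5 ∸ 3 * k) * (2 * (2 * k + 1) * w (suc n) k)  ≡⟨ cong ((4 * n + 5 ∸ 3 * k) *_) (G-vanishes 1+n<k) ⟩
    (4 * n + 5 ∸ 3 * k) * 0                                  ≡⟨ *-zeroʳ (4 * n + 5 ∸ 3 * k) ⟩
    0                                                        ∎

  private
    m≡n+o⇒m∸o≡n : ∀ m n o → m ≡ n + o → m ∸ o ≡ n
    m≡n+o⇒m∸o≡n _ n o refl = m+n∸n≡m n o

  G-ratio : ∀ k i → suc i * suc i * G (k + i) k ≡ k * k * k * w (k + i) k
  G-ratio zero    i = *-zeroʳ (suc i * suc i)
  G-ratio (suc k) i = begin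
    suc i * suc i * (2 * (2 * k + 1) * w (suc k + i) k)
      ≡⟨ cong (λ d → d * d * (2 * (2 * k + 1) * w (suc k + i) k)) (m≡n+o⇒m∸o≡n (suc k + i) (suc i) k (solve (k ∷ i ∷ []))) ⟨
    (suc k + i ∸ k) * (suc k + i ∸ k) * (2 * (2 * k + 1) * w (suc k + i) k)
      ≡⟨ w-ratio-k (suc k + i) k ⟩
    suc k * suc k * suc k * w (suc k + i) (suc k) ∎

  H-ratio : ∀ k i → suc (suc i) * suc (suc i) * H (k + i) k ≡ k * k * k * (k + 4 * i + 8) * w (suc (k + i)) k
  H-ratio zero    i = *-zeroʳ (suc (suc i) * suc (suc i))
  H-ratio (suc k) i = begin
    d * d * ((4 * (suc k + i) + 5 ∸ 3 * k) * u)
      ≡⟨ cong (λ m → d * d * (m * u)) (m≡n+o⇒m∸o≡n (4 * (suc k + i) + 5) (suc k + 4 * i + 8) (3 * k) (solve (k ∷ i ∷ []))) ⟩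
    d * d * ((suc k + 4 * i + 8) * u)
      ≡⟨ x∙yz≈y∙xz (d * d) (suc k + 4 * i + 8) u ⟩
    (suc k + 4 * i + 8) * (d * d * u)
      ≡⟨ cong (λ m → (suc k + 4 * i + 8) * (m * m * u)) (m≡n+o⇒m∸o≡n (suc (suc k + i)) (suc (suc i)) k (solve (k ∷ i ∷ []))) ⟨
    (suc k + 4 * i + 8) * ((suc (suc k + i) ∸ k) * (suc (suc k + i) ∸ k) * u)
      ≡⟨ cong ((suc k + 4 * i + 8) *_) (w-ratio-k (suc (suc k + i)) k) ⟩
    (suc k + 4 * i + 8) * (suc k * suc k * suc k * w (suc (suc k + i)) (suc k))
      ≡⟨ x∙yz≈y∙xz (suc k + 4 * i + 8) (suc k * suc k * suc k) _ ⟩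
    suc k * suc k * suc k * ((suc k + 4 * i + 8) * w (suc (suc k + i)) (suc k))
      ≡⟨ *-assoc (suc k * suc k * suc k) (suc k + 4 * i + 8) _ ⟨
    suc k * suc k * suc k * (suc k + 4 * i + 8) * w (suc (suc k + i)) (suc k) ∎
    where
      d = suc (suc i)
      u = 2 * (2 * k + 1) * w (suc (suc k + i)) k

  G-identity-below : ∀ k i →
    (4 * (k + i) + 3) * w (k + i) k + 3 * s (suc (k + i)) k + 2 * G (k + i) (suc k)
    ≡ 3 * s (k + i) k + (4 * (k + i) + 7) * w (suc (k + i)) k + 2 * G (k + i) k
  G-identity-below k i = by-ratios (w (k + i) k) (w (suc (k + i)) k) (G (k + i) k) ratio-n (G-ratio k i)
    where
      ratio-n : suc (k + i) * suc (k + i) * w (k + i) k ≡ suc i * suc i * w (suc (k + i)) k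
      ratio-n = trans (w-ratio-n (k + i) k)
        (cong (λ d → d * d * w (suc (k + i)) k) (m≡n+o⇒m∸o≡n (suc (k + i)) (suc i) k (solve (k ∷ i ∷ []))))
      -- Multiplied by (i+1)², both sides become polynomial multiples of x through the term ratios.
      by-ratios : ∀ x y g →
        suc (k + i) * suc (k + i) * x ≡ suc i * suc i * y → suc i * suc i * g ≡ k * k * k * x →
        (4 * (k + i) + 3) * x + 3 * (y * (2 * k + 1)) + 2 * (2 * (2 * k + 1) * x)
        ≡ 3 * (x * (2 * k + 1)) + (4 * (k + i) + 7) * y + 2 * g
      by-ratios x y g ratio-y ratio-g = *-cancelˡ-≡ _ _ (suc i * suc i) (begin
        suc i * suc i * ((4 * (k + i) + 3) * x + 3 * (y * (2 * k + 1)) + 2 * (2 * (2 * k + 1) * x))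
          ≡⟨ solve (k ∷ i ∷ x ∷ y ∷ []) ⟩
        (4 * (k + i) + 3 + 4 * (2 * k + 1)) * (suc i * suc i * x) + 3 * (2 * k + 1) * (suc i * suc i * y)
          ≡⟨ cong ((4 * (k + i) + 3 + 4 * (2 * k + 1)) * (suc i * suc i * x) +_) (cong (3 * (2 * k + 1) *_) ratio-y) ⟨
        (4 * (k + i) + 3 + 4 * (2 * k + 1)) * (suc i * suc i * x) + 3 * (2 * k + 1) * (suc (k + i) * suc (k + i) * x)
          ≡⟨ solve (k ∷ i ∷ x ∷ []) ⟩
        3 * (2 * k + 1) * (suc i * suc i * x) + (4 * (k + i) + 7) * (suc (k + i) * suc (k + i) * x) + 2 * (k * k * k * x)
          ≡⟨ cong₂ (λ u v → 3 * (2 * k + 1) * (suc i * suc i * x) + (4 * (k + i) + 7) * u + 2 * v) ratio-y (sym ratio-g) ⟩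
        3 * (2 * k + 1) * (suc i * suc i * x) + (4 * (k + i) + 7) * (suc i * suc i * y) + 2 * (suc i * suc i * g)
          ≡⟨ solve (k ∷ i ∷ x ∷ y ∷ g ∷ []) ⟩
        suc i * suc i * (3 * (x * (2 * k + 1)) + (4 * (k + i) + 7) * y + 2 * g) ∎)

  G-identity-edge : ∀ n →
    (4 * n + 3) * w n (suc n) + 3 * s (suc n) (suc n) + 2 * G n (suc (suc n))
    ≡ 3 * s n (suc n) + (4 * n + 7) * w (suc n) (suc n) + 2 * G n (suc n)
  G-identity-edge n = by-ratios (w n (suc n)) (w (suc n) (suc n)) (w n n) (w-vanishes (n<1+n n)) (w-diagonal-ratio n)
    where
      by-ratios : ∀ z c c₀ → z ≡ 0 → suc n * c ≡ 2 * (2 * n + 1) * c₀ →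
        (4 * n + 3) * z + 3 * (c * (2 * suc n + 1)) + 2 * (2 * (2 * suc n + 1) * z)
        ≡ 3 * (z * (2 * suc n + 1)) + (4 * n + 7) * c + 2 * (2 * (2 * n + 1) * c₀)
      by-ratios .0 c c₀ refl [n+1]c≡2[2n+1]c₀ = begin
        (4 * n + 3) * 0 + 3 * (c * (2 * suc n + 1)) + 2 * (2 * (2 * suc n + 1) * 0)
          ≡⟨ solve (n ∷ c ∷ []) ⟩
        (4 * n + 7) * c + 2 * (suc n * c)
          ≡⟨ cong (λ u → (4 * n + 7) * c + 2 * u) [n+1]c≡2[2n+1]c₀ ⟩
        (4 * n + 7) * c + 2 * (2 * (2 * n + 1) * c₀)
          ≡⟨ solve (n ∷ c ∷ c₀ ∷ []) ⟩
        3 * (0 * (2 * suc n + 1)) + (4 * n + 7) * c + 2 * (2 * (2 * n + 1) * c₀) ∎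

  G-identity : ∀ n k → k < 2 + n →
    (4 * n + 3) * w n k + 3 * s (suc n) k + 2 * G n (suc k) ≡ 3 * s n k + (4 * n + 7) * w (suc n) k + 2 * G n k
  G-identity n k k<2+n with m≤n⇒m<n∨m≡n (≤-pred k<2+n)
  ... | inj₂ refl = G-identity-edge n
  ... | inj₁ k<1+n with m≤n⇒∃[o]m+o≡n (≤-pred k<1+n)
  ...   | i , refl = G-identity-below k i

  H-identity-below : ∀ k i →
    9 * suc (k + i) * suc (k + i) * w (k + i) k + (2 + (k + i)) * (2 + (k + i)) * w (2 + (k + i)) k + H (k + i) (suc k)
    ≡ (10 * (k + i) * (k + i) + 30 * (k + i) + 23) * w (suc (k + i)) k + H (k + i) k
  H-identity-below k i =
    by-ratios (w (k + i) k) (w (suc (k + i)) k) (w (2 + (k + i)) k) (H (k + i) k) (4 * (k + i) + 5 ∸ 3 * k)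
      (ratio (k + i) (suc i) (solve (k ∷ i ∷ []))) (ratio (suc (k + i)) (2 + i) (solve (k ∷ i ∷ []))) (H-ratio k i)
      (m≡n+o⇒m∸o≡n (4 * (k + i) + 5) (k + 4 * i + 5) (3 * k) (solve (k ∷ i ∷ [])))
    where
      ratio : ∀ m j → suc m ≡ k + j → suc m * suc m * w m k ≡ j * j * w (suc m) k
      ratio m j 1+m≡k+j = trans (w-ratio-n m k)
        (cong (λ d → d * d * w (suc m) k) (m≡n+o⇒m∸o≡n (suc m) j k (trans 1+m≡k+j (+-comm k j))))
      by-ratios : ∀ x y z h e →
        suc (k + i) * suc (k + i) * x ≡ suc i * suc i * y →
        (2 + (k + i)) * (2 + (k + i)) * y ≡ (2 + i) * (2 + i) * z →
        (2 + i) * (2 + i) * h ≡ k * k * k * (k + 4 * i + 8) * y →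
        e ≡ k + 4 * i + 5 →
        9 * suc (k + i) * suc (k + i) * x + (2 + (k + i)) * (2 + (k + i)) * z + e * (2 * (2 * k + 1) * y)
        ≡ (10 * (k + i) * (k + i) + 30 * (k + i) + 23) * y + h
      by-ratios x y z h .(k + 4 * i + 5) ratio-x ratio-z ratio-h refl = *-cancelˡ-≡ _ _ ((2 + i) * (2 + i)) (begin
        (2 + i) * (2 + i) * (9 * suc (k + i) * suc (k + i) * x + (2 + (k + i)) * (2 + (k + i)) * z
          + (k + 4 * i + 5) * (2 * (2 * k + 1) * y))
          ≡⟨ solve (k ∷ i ∷ x ∷ y ∷ z ∷ []) ⟩
        9 * ((2 + i) * (2 + i)) * (suc (k + i) * suc (k + i) * x) + (2 + (k + i)) * (2 + (k + i)) * ((2 + i) * (2 + i) * z)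
          + (2 + i) * (2 + i) * (k + 4 * i + 5) * (2 * (2 * k + 1) * y)
          ≡⟨ cong₂ (λ u v → 9 * ((2 + i) * (2 + i)) * u + (2 + (k + i)) * (2 + (k + i)) * v
                            + (2 + i) * (2 + i) * (k + 4 * i + 5) * (2 * (2 * k + 1) * y)) ratio-x (sym ratio-z) ⟩
        9 * ((2 + i) * (2 + i)) * (suc i * suc i * y) + (2 + (k + i)) * (2 + (k + i)) * ((2 + (k + i)) * (2 + (k + i)) * y)
          + (2 + i) * (2 + i) * (k + 4 * i + 5) * (2 * (2 * k + 1) * y)
          ≡⟨ solve (k ∷ i ∷ y ∷ []) ⟩
        (2 + i) * (2 + i) * ((10 * (k + i) * (k + i) + 30 * (k + i) + 23) * y) + k * k * k * (k + 4 * i + 8) * y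
          ≡⟨ cong ((2 + i) * (2 + i) * ((10 * (k + i) * (k + i) + 30 * (k + i) + 23) * y) +_) ratio-h ⟨
        (2 + i) * (2 + i) * ((10 * (k + i) * (k + i) + 30 * (k + i) + 23) * y) + (2 + i) * (2 + i) * h
          ≡⟨ *-distribˡ-+ ((2 + i) * (2 + i)) ((10 * (k + i) * (k + i) + 30 * (k + i) + 23) * y) h ⟨
        (2 + i) * (2 + i) * ((10 * (k + i) * (k + i) + 30 * (k + i) + 23) * y + h) ∎)

  H-identity-edge₁ : ∀ n →
    9 * suc n * suc n * w n (suc n) + (2 + n) * (2 + n) * w (2 + n) (suc n) + H n (2 + n)
    ≡ (10 * n * n + 30 * n + 23) * w (suc n) (suc n) + H n (suc n)
  H-identity-edge₁ n = by-ratios (w n (suc n)) (w (suc n) (suc n)) (w (2 + n) (suc n)) (2 * (2 * n + 1) * w (suc n) n)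
    (4 * n + 5 ∸ 3 * suc n) (4 * n + 5 ∸ 3 * n) (w-vanishes (n<1+n n)) z-ratio v-ratio
    (m≡n+o⇒m∸o≡n (4 * n + 5) (2 + n) (3 * suc n) (solve (n ∷ [])))
    (m≡n+o⇒m∸o≡n (4 * n + 5) (n + 5) (3 * n) (solve (n ∷ [])))
    where
      1+n∸n≡1 : suc n ∸ n ≡ 1
      1+n∸n≡1 = m≡n+o⇒m∸o≡n (suc n) 1 n refl
      z-ratio : w (2 + n) (suc n) ≡ (2 + n) * (2 + n) * w (suc n) (suc n)
      z-ratio = begin
        w (2 + n) (suc n)                                        ≡⟨ *-identityˡ _ ⟨
        1 * 1 * w (2 + n) (suc n)                                ≡⟨ cong (λ d → d * d * w (2 + n) (suc n)) 1+n∸n≡1 ⟨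
        (suc n ∸ n) * (suc n ∸ n) * w (2 + n) (suc n)            ≡⟨ w-ratio-n (suc n) (suc n) ⟨
        (2 + n) * (2 + n) * w (suc n) (suc n)                    ∎
      v-ratio : 2 * (2 * n + 1) * w (suc n) n ≡ suc n * suc n * suc n * w (suc n) (suc n)
      v-ratio = begin
        2 * (2 * n + 1) * w (suc n) n                            ≡⟨ *-identityˡ _ ⟨
        1 * 1 * (2 * (2 * n + 1) * w (suc n) n)                  ≡⟨ cong (λ d → d * d * (2 * (2 * n + 1) * w (suc n) n)) 1+n∸n≡1 ⟨
        (suc n ∸ n) * (suc n ∸ n) * (2 * (2 * n + 1) * w (suc n) n)  ≡⟨ w-ratio-k (suc n) n ⟩
        suc n * suc n * suc n * w (suc n) (suc n)                ∎
      by-ratios : ∀ x y z v e₁ e₂ → x ≡ 0 → z ≡ (2 + n) * (2 + n) * y → v ≡ suc n * suc n * suc n * y →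
        e₁ ≡ 2 + n → e₂ ≡ n + 5 →
        9 * suc n * suc n * x + (2 + n) * (2 + n) * z + e₁ * (2 * (2 * suc n + 1) * y)
        ≡ (10 * n * n + 30 * n + 23) * y + e₂ * v
      by-ratios .0 y ._ ._ ._ ._ refl refl refl refl refl = solve (n ∷ y ∷ [])

  H-identity-edge₂ : ∀ n →
    9 * suc n * suc n * w n (2 + n) + (2 + n) * (2 + n) * w (2 + n) (2 + n) + H n (3 + n)
    ≡ (10 * n * n + 30 * n + 23) * w (suc n) (2 + n) + H n (2 + n)
  H-identity-edge₂ n = by-ratios (w n (2 + n)) (w (suc n) (2 + n)) (w (2 + n) (2 + n)) (w (suc n) (suc n))
    (4 * n + 5 ∸ 3 * suc n) (4 * n + 5 ∸ 3 * (2 + n)) (w-vanishes (m≤n⇒m≤1+n (n<1+n n))) (w-vanishes (n<1+n (suc n)))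
    (m≡n+o⇒m∸o≡n (4 * n + 5) (2 + n) (3 * suc n) (solve (n ∷ []))) (w-diagonal-ratio (suc n))
    where
      by-ratios : ∀ x y z c e junk → x ≡ 0 → y ≡ 0 → e ≡ 2 + n → (2 + n) * z ≡ 2 * (2 * suc n + 1) * c →
        9 * suc n * suc n * x + (2 + n) * (2 + n) * z + junk * (2 * (2 * (2 + n) + 1) * y)
        ≡ (10 * n * n + 30 * n + 23) * y + e * (2 * (2 * suc n + 1) * c)
      by-ratios .0 .0 z c ._ junk refl refl refl [2+n]z≡2[2n+3]c = begin
        9 * suc n * suc n * 0 + (2 + n) * (2 + n) * z + junk * (2 * (2 * (2 + n) + 1) * 0)
          ≡⟨ solve (n ∷ z ∷ junk ∷ []) ⟩
        (2 + n) * ((2 + n) * z)                                   ≡⟨ cong ((2 + n) *_) [2+n]z≡2[2n+3]c ⟩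
        (2 + n) * (2 * (2 * suc n + 1) * c)                       ≡⟨ solve (n ∷ c ∷ []) ⟩
        (10 * n * n + 30 * n + 23) * 0 + (2 + n) * (2 * (2 * suc n + 1) * c) ∎

  H-identity : ∀ n k → k < 3 + n →
    9 * suc n * suc n * w n k + (2 + n) * (2 + n) * w (2 + n) k + H n (suc k)
    ≡ (10 * n * n + 30 * n + 23) * w (suc n) k + H n k
  H-identity n k k<3+n with m≤n⇒m<n∨m≡n (≤-pred k<3+n)
  ... | inj₂ refl = H-identity-edge₂ n
  ... | inj₁ k<2+n with m≤n⇒m<n∨m≡n (≤-pred k<2+n)
  ...   | inj₂ refl = H-identity-edge₁ n
  ...   | inj₁ k<1+n with m≤n⇒∃[o]m+o≡n (≤-pred k<1+n)
  ...     | i , refl = H-identity-below k i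

  ∑-w≡W : ∀ n m → n < m → ∑ m (w n) ≡ W n
  ∑-w≡W n m n<m = ∑-zero-tail m (w n) (λ k → w-vanishes) n<m

  ∑-s≡S : ∀ n m → n < m → ∑ m (s n) ≡ S n
  ∑-s≡S n m n<m = begin
    ∑ m (s n)        ≡⟨ ∑-zero-tail m (s n) (λ k n<k → cong (_* (2 * k + 1)) (w-vanishes n<k)) n<m ⟩
    ∑ (suc n) (s n)  ≡⟨ sum-map-upTo (suc n) (s n) ⟨
    S n              ∎

  S-W-step : ∀ n → (4 * n + 3) * W n + 3 * S (suc n) ≡ 3 * S n + (4 * n + 7) * W (suc n)
  S-W-step n = begin
    (4 * n + 3) * W n + 3 * S (suc n)
      ≡⟨ cong₂ (λ u v → (4 * n + 3) * u + 3 * v) (∑-w≡W n m (m≤n⇒m≤1+n (n<1+n n))) (∑-s≡S (suc n) m (n<1+n (suc n))) ⟨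
    (4 * n + 3) * ∑ m (w n) + 3 * ∑ m (s (suc n))
      ≡⟨ ∑-linear m (4 * n + 3) 3 (w n) (s (suc n)) ⟨
    ∑ m (λ k → (4 * n + 3) * w n k + 3 * s (suc n) k)
      ≡⟨ ∑-telescope m (G-identity n) refl (cong (2 *_) (G-vanishes (n<1+n n))) ⟩
    ∑ m (λ k → 3 * s n k + (4 * n + 7) * w (suc n) k)
      ≡⟨ ∑-linear m 3 (4 * n + 7) (s n) (w (suc n)) ⟩
    3 * ∑ m (s n) + (4 * n + 7) * ∑ m (w (suc n))
      ≡⟨ cong₂ (λ u v → 3 * u + (4 * n + 7) * v) (∑-s≡S n m (m≤n⇒m≤1+n (n<1+n n))) (∑-w≡W (suc n) m (n<1+n (suc n))) ⟩
    3 * S n + (4 * n + 7) * W (suc n) ∎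
    where m = 2 + n

  3S≡[4n+3]W : ∀ n → 3 * S n ≡ (4 * n + 3) * W n
  3S≡[4n+3]W zero    = refl
  3S≡[4n+3]W (suc n) = begin
    3 * S (suc n)                 ≡⟨ +-cancelˡ-≡ ((4 * n + 3) * W n) _ _ (trans (S-W-step n) (cong (_+ (4 * n + 7) * W (suc n)) (3S≡[4n+3]W n))) ⟩
    (4 * n + 7) * W (suc n)       ≡⟨ cong (_* W (suc n)) 4n+7≡4[n+1]+3 ⟩
    (4 * suc n + 3) * W (suc n)   ∎
    where
      4n+7≡4[n+1]+3 : 4 * n + 7 ≡ 4 * suc n + 3
      4n+7≡4[n+1]+3 = solve (n ∷ [])

  W-recurrence : ∀ n →
    9 * suc n * suc n * W n + (2 + n) * (2 + n) * W (2 + n) ≡ (10 * n * n + 30 * n + 23) * W (suc n)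
  W-recurrence n = begin
    9 * suc n * suc n * W n + (2 + n) * (2 + n) * W (2 + n)
      ≡⟨ cong₂ (λ u v → 9 * suc n * suc n * u + (2 + n) * (2 + n) * v)
           (∑-w≡W n m (m≤n⇒m≤1+n (m≤n⇒m≤1+n (n<1+n n)))) (∑-w≡W (2 + n) m (n<1+n (2 + n))) ⟨
    9 * suc n * suc n * ∑ m (w n) + (2 + n) * (2 + n) * ∑ m (w (2 + n))
      ≡⟨ ∑-linear m (9 * suc n * suc n) ((2 + n) * (2 + n)) (w n) (w (2 + n)) ⟨
    ∑ m (λ k → 9 * suc n * suc n * w n k + (2 + n) * (2 + n) * w (2 + n) k)
      ≡⟨ ∑-telescope m (H-identity n) refl (H-vanishes (n<1+n (suc n))) ⟩
    ∑ m (λ k → (10 * n * n + 30 * n + 23) * w (suc n) k)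
      ≡⟨ *-distribˡ-∑ m (10 * n * n + 30 * n + 23) (w (suc n)) ⟩
    (10 * n * n + 30 * n + 23) * ∑ m (w (suc n))
      ≡⟨ cong ((10 * n * n + 30 * n + 23) *_) (∑-w≡W (suc n) m (m≤n⇒m≤1+n (n<1+n (suc n)))) ⟩
    (10 * n * n + 30 * n + 23) * W (suc n) ∎
    where m = 3 + n

  α β γ : ℕ → ℕ
  α n = 9 * suc n * suc n * (7 + 4 * n) * (11 + 4 * n)
  β n = (2 + n) * (2 + n) * (3 + 4 * n) * (7 + 4 * n)
  γ n = (23 + 30 * n + 10 * n * n) * (3 + 4 * n) * (11 + 4 * n)

  S-recurrence : ∀ n → α n * S n + β n * S (2 + n) ≡ γ n * S (suc n)
  S-recurrence n = combine (S n) (S (suc n)) (S (2 + n)) (W n) (W (suc n)) (W (2 + n))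
    (3S≡[4n+3]W n) (3S≡[4n+3]W (suc n)) (3S≡[4n+3]W (2 + n)) (W-recurrence n)
    where
      combine : ∀ a b c A B C →
        3 * a ≡ (4 * n + 3) * A → 3 * b ≡ (4 * suc n + 3) * B → 3 * c ≡ (4 * (2 + n) + 3) * C →
        9 * suc n * suc n * A + (2 + n) * (2 + n) * C ≡ (10 * n * n + 30 * n + 23) * B →
        α n * a + β n * c ≡ γ n * b
      combine a b c A B C 3a≡ 3b≡ 3c≡ rec = *-cancelˡ-≡ _ _ 3 (begin
        3 * (9 * suc n * suc n * (7 + 4 * n) * (11 + 4 * n) * a + (2 + n) * (2 + n) * (3 + 4 * n) * (7 + 4 * n) * c)
          ≡⟨ solve (n ∷ a ∷ c ∷ []) ⟩
        9 * suc n * suc n * (7 + 4 * n) * (11 + 4 * n) * (3 * a) + (2 + n) * (2 + n) * (3 + 4 * n) * (7 + 4 * n) * (3 * c)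
          ≡⟨ cong₂ (λ u v → 9 * suc n * suc n * (7 + 4 * n) * (11 + 4 * n) * u + (2 + n) * (2 + n) * (3 + 4 * n) * (7 + 4 * n) * v) 3a≡ 3c≡ ⟩
        9 * suc n * suc n * (7 + 4 * n) * (11 + 4 * n) * ((4 * n + 3) * A)
          + (2 + n) * (2 + n) * (3 + 4 * n) * (7 + 4 * n) * ((4 * (2 + n) + 3) * C)
          ≡⟨ solve (n ∷ A ∷ C ∷ []) ⟩
        (4 * n + 3) * (4 * n + 7) * (4 * n + 11) * (9 * suc n * suc n * A + (2 + n) * (2 + n) * C)
          ≡⟨ cong ((4 * n + 3) * (4 * n + 7) * (4 * n + 11) *_) rec ⟩
        (4 * n + 3) * (4 * n + 7) * (4 * n + 11) * ((10 * n * n + 30 * n + 23) * B)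
          ≡⟨ solve (n ∷ B ∷ []) ⟩
        (23 + 30 * n + 10 * n * n) * (3 + 4 * n) * (11 + 4 * n) * ((4 * suc n + 3) * B)
          ≡⟨ cong ((23 + 30 * n + 10 * n * n) * (3 + 4 * n) * (11 + 4 * n) *_) 3b≡ ⟨
        (23 + 30 * n + 10 * n * n) * (3 + 4 * n) * (11 + 4 * n) * (3 * b)
          ≡⟨ solve (n ∷ b ∷ []) ⟩
        3 * ((23 + 30 * n + 10 * n * n) * (3 + 4 * n) * (11 + 4 * n) * b) ∎)

module RatioBounds where

  open import Data.Nat
  open import Data.Nat.Properties
  open import Data.Nat.Tactic.RingSolver using (solve)
  open import Data.List.Base using (_∷_; [])
  open import Relation.Binary.PropositionalEquality
  open Recurrences using (α; β; γ; S-recurrence)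
  open import Algebra.Properties.CommutativeSemigroup *-commutativeSemigroup using (x∙yz≈y∙xz)

  recurrence-ratio-≤ : ∀ α β γ {a b c} p q r s → .{{_ : NonZero (β * q)}} →
    α * a + β * c ≡ γ * b → p * b ≤ q * a → γ * q * s ≤ β * q * r + α * p * s → s * c ≤ r * b
  recurrence-ratio-≤ α β γ {a} {b} {c} p q r s rec pb≤qa margin =
    *-cancelˡ-≤ (β * q) (+-cancelʳ-≤ (α * p * s * b) (β * q * (s * c)) (β * q * (r * b)) (begin
      β * q * (s * c) + α * p * s * b    ≡⟨ solve (α ∷ β ∷ b ∷ c ∷ p ∷ q ∷ s ∷ []) ⟩
      q * s * (β * c) + α * s * (p * b)  ≤⟨ +-monoʳ-≤ (q * s * (β * c)) (*-monoʳ-≤ (α * s) pb≤qa) ⟩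
      q * s * (β * c) + α * s * (q * a)  ≡⟨ solve (α ∷ β ∷ a ∷ c ∷ q ∷ s ∷ []) ⟩
      q * s * (α * a + β * c)            ≡⟨ cong (q * s *_) rec ⟩
      q * s * (γ * b)                    ≡⟨ solve (γ ∷ b ∷ q ∷ s ∷ []) ⟩
      γ * q * s * b                      ≤⟨ *-monoˡ-≤ b margin ⟩
      (β * q * r + α * p * s) * b        ≡⟨ solve (α ∷ β ∷ b ∷ p ∷ q ∷ r ∷ s ∷ []) ⟩
      β * q * (r * b) + α * p * s * b    ∎))
    where open ≤-Reasoning

  recurrence-ratio-≥ : ∀ α β γ {a b c} p q r s → .{{_ : NonZero (β * q)}} →
    α * a + β * c ≡ γ * b → q * a ≤ p * b → β * q * r + α * p * s ≤ γ * q * s → r * b ≤ s * c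
  recurrence-ratio-≥ α β γ {a} {b} {c} p q r s rec qa≤pb margin =
    *-cancelˡ-≤ (β * q) (+-cancelʳ-≤ (α * p * s * b) (β * q * (r * b)) (β * q * (s * c)) (begin
      β * q * (r * b) + α * p * s * b    ≡⟨ solve (α ∷ β ∷ b ∷ p ∷ q ∷ r ∷ s ∷ []) ⟩
      (β * q * r + α * p * s) * b        ≤⟨ *-monoˡ-≤ b margin ⟩
      γ * q * s * b                      ≡⟨ solve (γ ∷ b ∷ q ∷ s ∷ []) ⟩
      q * s * (γ * b)                    ≡⟨ cong (q * s *_) rec ⟨
      q * s * (α * a + β * c)            ≡⟨ solve (α ∷ β ∷ a ∷ c ∷ q ∷ s ∷ []) ⟩
      α * s * (q * a) + β * q * (s * c)  ≤⟨ +-monoˡ-≤ (β * q * (s * c)) (*-monoʳ-≤ (α * s) qa≤pb) ⟩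
      α * s * (p * b) + β * q * (s * c)  ≡⟨ solve (α ∷ β ∷ b ∷ c ∷ p ∷ q ∷ s ∷ []) ⟩
      β * q * (s * c) + α * p * s * b    ∎))
    where open ≤-Reasoning

  ≤-by-margin : ∀ {a b m m′} → a + m ≡ b + m′ → m′ ≤ m → a ≤ b
  ≤-by-margin {a} {b} {m} {m′} a+m≡b+m′ m′≤m = +-cancelʳ-≤ m a b (begin
    a + m   ≡⟨ a+m≡b+m′ ⟩
    b + m′  ≤⟨ +-monoʳ-≤ b m′≤m ⟩
    b + m   ∎)
    where open ≤-Reasoning

  S-ratio-upper : ∀ n → S (suc n) ≤ 9 * S n
  S-ratio-upper zero    = ≤ᵇ⇒≤ (S 1) (9 * S 0) _
  S-ratio-upper (suc n) = begin
    S (2 + n)      ≡⟨ *-identityˡ (S (2 + n)) ⟨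
    1 * S (2 + n)  ≤⟨ recurrence-ratio-≤ (α n) (β n) (γ n) {S n} {S (suc n)} {S (2 + n)} 1 9 9 1 (S-recurrence n) 1*S[1+n]≤9*S[n] margin ⟩
    9 * S (suc n)  ∎
    where
      open ≤-Reasoning
      1*S[1+n]≤9*S[n] : 1 * S (suc n) ≤ 9 * S n
      1*S[1+n]≤9*S[n] = ≤-trans (≤-reflexive (*-identityˡ (S (suc n)))) (S-ratio-upper n)
      margin : (23 + 30 * n + 10 * n * n) * (3 + 4 * n) * (11 + 4 * n) * 9 * 1
               ≤ (2 + n) * (2 + n) * (3 + 4 * n) * (7 + 4 * n) * 9 * 9 + 9 * suc n * suc n * (7 + 4 * n) * (11 + 4 * n) * 1 * 1
      margin = ≤-by-margin {m = 666 + 1296 * n + 576 * n * n} {m′ = 0} (solve (n ∷ [])) z≤n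

  S-ratio-lower-margin : ∀ n → 1 ≤ n →
    (2 + n) * (2 + n) * (3 + 4 * n) * (7 + 4 * n) * (2 + 18 * n + 9 * n * n) * (2 + 18 * suc n + 9 * suc n * suc n)
    + 9 * suc n * suc n * (7 + 4 * n) * (11 + 4 * n) * (suc n * suc n) * ((2 + n) * (2 + n))
    ≤ (23 + 30 * n + 10 * n * n) * (3 + 4 * n) * (11 + 4 * n) * (2 + 18 * n + 9 * n * n) * ((2 + n) * (2 + n))
  S-ratio-lower-margin n 1≤n = ≤-by-margin
    {m = 5791 * n * n + (11612 * n * n * n + 8262 * n * n * n * n + 2640 * n * n * n * n * n + 320 * n * n * n * n * n * n)}
    {m′ = 1572 + 1556 * n} (solve (n ∷ [])) (begin
      1572 + 1556 * n      ≤⟨ +-monoˡ-≤ (1556 * n) (*-monoʳ-≤ 1572 1≤n) ⟩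
      1572 * n + 1556 * n  ≡⟨ *-distribʳ-+ n 1572 1556 ⟨
      3128 * n             ≤⟨ *-mono-≤ (≤ᵇ⇒≤ 3128 5791 _) (m≤m*n n n {{>-nonZero 1≤n}}) ⟩
      5791 * (n * n)       ≡⟨ *-assoc 5791 n n ⟨
      5791 * n * n         ≤⟨ m≤m+n (5791 * n * n) _ ⟩
      _                    ∎)
    where open ≤-Reasoning

  S-ratio-lower : ∀ n → (2 + 18 * n + 9 * n * n) * S n ≤ suc n * suc n * S (suc n)
  S-ratio-lower 0 = ≤ᵇ⇒≤ _ _ _
  S-ratio-lower 1 = ≤ᵇ⇒≤ _ _ _
  S-ratio-lower (suc n@(suc _)) =
    recurrence-ratio-≥ (α n) (β n) (γ n) {S n} {S (suc n)} {S (2 + n)} (suc n * suc n) (2 + 18 * n + 9 * n * n)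
      (2 + 18 * suc n + 9 * suc n * suc n) ((2 + n) * (2 + n))
      (S-recurrence n) (S-ratio-lower n) (S-ratio-lower-margin n (s≤s z≤n))

  S≤9^n : ∀ n → S n ≤ 9 ^ n
  S≤9^n zero    = ≤-refl
  S≤9^n (suc n) = ≤-trans (S-ratio-upper n) (*-monoʳ-≤ 9 (S≤9^n n))

  S[1+n]≤7*9^n : ∀ n → S (suc n) ≤ 7 * 9 ^ n
  S[1+n]≤7*9^n zero    = ≤-refl
  S[1+n]≤7*9^n (suc n) = begin
    S (2 + n)        ≤⟨ S-ratio-upper (suc n) ⟩
    9 * S (suc n)    ≤⟨ *-monoʳ-≤ 9 (S[1+n]≤7*9^n n) ⟩
    9 * (7 * 9 ^ n)  ≡⟨ x∙yz≈y∙xz 9 7 (9 ^ n) ⟩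
    7 * 9 ^ suc n    ∎
    where open ≤-Reasoning

  9n*S[n]≤[1+n]*S[1+n] : ∀ n → 9 * n * S n ≤ suc n * S (suc n)
  9n*S[n]≤[1+n]*S[1+n] n = *-cancelˡ-≤ (suc n) (weaken (S n) (S (suc n)) (S-ratio-lower n))
    where
      open ≤-Reasoning
      weaken : ∀ x y → (2 + 18 * n + 9 * n * n) * x ≤ suc n * suc n * y → suc n * (9 * n * x) ≤ suc n * (suc n * y)
      weaken x y qx≤py = begin
        suc n * (9 * n * x)                      ≤⟨ m≤m+n _ ((2 + 9 * n) * x) ⟩
        suc n * (9 * n * x) + (2 + 9 * n) * x    ≡⟨ solve (n ∷ x ∷ []) ⟩
        (2 + 18 * n + 9 * n * n) * x             ≤⟨ qx≤py ⟩
        suc n * suc n * y                        ≡⟨ *-assoc (suc n) (suc n) y ⟩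
        suc n * (suc n * y)                      ∎

  9^n≤[1+n]*S[1+n] : ∀ n → 9 ^ n ≤ suc n * S (suc n)
  9^n≤[1+n]*S[1+n] zero    = s≤s z≤n
  9^n≤[1+n]*S[1+n] (suc n) = begin
    9 * 9 ^ n                  ≤⟨ *-monoʳ-≤ 9 (9^n≤[1+n]*S[1+n] n) ⟩
    9 * (suc n * S (suc n))    ≡⟨ *-assoc 9 (suc n) (S (suc n)) ⟨
    9 * suc n * S (suc n)      ≤⟨ 9n*S[n]≤[1+n]*S[1+n] (suc n) ⟩
    suc (suc n) * S (2 + n)    ∎
    where open ≤-Reasoning

module Growth where

  open import Data.Nat
  open import Data.Nat.Properties
  open import Data.Nat.Tactic.RingSolver using (solve)
  open import Data.List.Base using (_∷_; [])
  open import Relation.Binary.PropositionalEquality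
  open import Algebra.Properties.CommutativeSemigroup *-commutativeSemigroup using (interchange)
  open RatioBounds

  ^-distribʳ-* : ∀ m n o → (m * n) ^ o ≡ m ^ o * n ^ o
  ^-distribʳ-* m n zero    = refl
  ^-distribʳ-* m n (suc o) = begin
    m * n * (m * n) ^ o      ≡⟨ cong (m * n *_) (^-distribʳ-* m n o) ⟩
    m * n * (m ^ o * n ^ o)  ≡⟨ interchange m n (m ^ o) (n ^ o) ⟩
    m ^ suc o * n ^ suc o    ∎
    where open ≡-Reasoning

  [x+b]^[1+k]≤x^[1+k]+[1+k]*b*[x+b]^k : ∀ x b k → (x + b) ^ suc k ≤ x ^ suc k + suc k * b * (x + b) ^ k
  [x+b]^[1+k]≤x^[1+k]+[1+k]*b*[x+b]^k x b zero    = ≤-reflexive [x+b]*1≡x*1+1*b*1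
    where
      [x+b]*1≡x*1+1*b*1 : (x + b) * 1 ≡ x * 1 + 1 * b * 1
      [x+b]*1≡x*1+1*b*1 = solve (x ∷ b ∷ [])
  [x+b]^[1+k]≤x^[1+k]+[1+k]*b*[x+b]^k x b (suc k) =
    step (x ^ suc k) ((x + b) ^ k) ([x+b]^[1+k]≤x^[1+k]+[1+k]*b*[x+b]^k x b k) (^-monoˡ-≤ (suc k) (m≤m+n x b))
    where
      open ≤-Reasoning
      step : ∀ X Y → (x + b) * Y ≤ X + suc k * b * Y → X ≤ (x + b) * Y →
             (x + b) * ((x + b) * Y) ≤ x * X + suc (suc k) * b * ((x + b) * Y)
      step X Y ih X≤[x+b]Y = begin
        (x + b) * ((x + b) * Y)                               ≤⟨ *-monoʳ-≤ (x + b) ih ⟩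
        (x + b) * (X + suc k * b * Y)                         ≡⟨ solve (x ∷ b ∷ k ∷ X ∷ Y ∷ []) ⟩
        x * X + b * X + suc k * b * ((x + b) * Y)             ≤⟨ +-monoˡ-≤ _ (+-monoʳ-≤ (x * X) (*-monoʳ-≤ b X≤[x+b]Y)) ⟩
        x * X + b * ((x + b) * Y) + suc k * b * ((x + b) * Y) ≡⟨ solve (x ∷ b ∷ k ∷ X ∷ Y ∷ []) ⟩
        x * X + suc (suc k) * b * ((x + b) * Y)               ∎

  7*9^m*p^[1+m]<x^[1+m] : ∀ m p x → x + 7 ≡ 9 * p → 7 * suc m < 2 * p → 7 * 9 ^ m * p ^ suc m < x ^ suc m
  7*9^m*p^[1+m]<x^[1+m] m zero    x _      ()
  7*9^m*p^[1+m]<x^[1+m] m p@(suc _) x x+7≡9p 7[1+m]<2p = +-cancelʳ-< c (7 * 9 ^ m * p ^ suc m) (x ^ suc m) (begin-strict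
    7 * 9 ^ m * p ^ suc m + c                   ≡⟨ cong (λ z → 7 * 9 ^ m * p ^ suc m + suc m * 7 * z) (^-distribʳ-* 9 p m) ⟩
    7 * 9 ^ m * (p * p ^ m) + suc m * 7 * (9 ^ m * p ^ m)
                                                ≡⟨ regroup p (9 ^ m) (p ^ m) ⟩
    9 ^ m * p ^ m * (7 * p + suc m * 7)         <⟨ *-monoʳ-< (9 ^ m * p ^ m) {{m*n≢0 (9 ^ m) (p ^ m) {{m^n≢0 9 m}} {{m^n≢0 p m}}}} 7p+7[1+m]<9p ⟩
    9 ^ m * p ^ m * (9 * p)                     ≡⟨ *-comm (9 ^ m * p ^ m) (9 * p) ⟩
    9 * p * (9 ^ m * p ^ m)                     ≡⟨ cong (9 * p *_) (^-distribʳ-* 9 p m) ⟨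
    (9 * p) ^ suc m                             ≡⟨ cong (_^ suc m) x+7≡9p ⟨
    (x + 7) ^ suc m                             ≤⟨ [x+b]^[1+k]≤x^[1+k]+[1+k]*b*[x+b]^k x 7 m ⟩
    x ^ suc m + suc m * 7 * (x + 7) ^ m         ≡⟨ cong (λ z → x ^ suc m + suc m * 7 * z ^ m) x+7≡9p ⟩
    x ^ suc m + c                               ∎)
    where
      open ≤-Reasoning
      c = suc m * 7 * (9 * p) ^ m
      regroup : ∀ q A B → 7 * A * (q * B) + suc m * 7 * (A * B) ≡ A * B * (7 * q + suc m * 7)
      regroup q A B = solve (q ∷ A ∷ B ∷ m ∷ [])
      7p+7[1+m]<9p : 7 * p + suc m * 7 < 9 * p
      7p+7[1+m]<9p = begin-strict
        7 * p + suc m * 7  ≡⟨ cong (7 * p +_) (*-comm (suc m) 7) ⟩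
        7 * p + 7 * suc m  <⟨ +-monoʳ-< (7 * p) 7[1+m]<2p ⟩
        7 * p + 2 * p      ≡⟨ *-distribʳ-+ p 7 2 ⟨
        9 * p              ∎

  S-root-increasing : ∀ m → S (suc m) ^ (2 + m) < S (2 + m) ^ suc m
  S-root-increasing m = *-cancelˡ-< (p ^ n) (s ^ suc n) (s′ ^ n) (begin-strict
    p ^ n * (s * s ^ n)  ≡⟨ regroup (p ^ n) s (s ^ n) ⟩
    s ^ n * (s * p ^ n)  <⟨ *-monoʳ-< (s ^ n) {{m^n≢0 s n}} s*p^n<x^n ⟩
    s ^ n * x ^ n        ≡⟨ *-comm (s ^ n) (x ^ n) ⟩
    x ^ n * s ^ n        ≡⟨ ^-distribʳ-* x s n ⟨
    (x * s) ^ n          ≤⟨ ^-monoˡ-≤ n (S-ratio-lower n) ⟩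
    (p * s′) ^ n         ≡⟨ ^-distribʳ-* p s′ n ⟩
    p ^ n * s′ ^ n       ∎)
    where
      open ≤-Reasoning
      n = suc m
      s = S n
      s′ = S (suc n)
      p = suc n * suc n
      x = 2 + 18 * n + 9 * n * n
      regroup : ∀ P A B → P * (A * B) ≡ B * (A * P)
      regroup P A B = solve (P ∷ A ∷ B ∷ [])
      x+7≡9p : 2 + 18 * suc m + 9 * suc m * suc m + 7 ≡ 9 * ((2 + m) * (2 + m))
      x+7≡9p = solve (m ∷ [])
      7n<2p : 7 * suc m < 2 * ((2 + m) * (2 + m))
      7n<2p = ≤-by-margin {m = 2 * m * m + m} {m′ = 0} (solve (m ∷ [])) z≤n
      s*p^n<x^n : s * p ^ n < x ^ n
      s*p^n<x^n = ≤-<-trans (*-monoˡ-≤ (p ^ n) (S[1+n]≤7*9^n m)) (7*9^m*p^[1+m]<x^[1+m] m p x x+7≡9p 7n<2p)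

  n*x^n≤x*[1+x]^n : ∀ x n → n * x ^ n ≤ x * suc x ^ n
  n*x^n≤x*[1+x]^n x zero    = z≤n
  n*x^n≤x*[1+x]^n x (suc n) = step (x ^ n) (suc x ^ n) (n*x^n≤x*[1+x]^n x n) (^-monoˡ-≤ n (n≤1+n x))
    where
      open ≤-Reasoning
      step : ∀ X Y → n * X ≤ x * Y → X ≤ Y → suc n * (x * X) ≤ x * (suc x * Y)
      step X Y nX≤xY X≤Y = begin
        suc n * (x * X)      ≡⟨ solve (n ∷ x ∷ X ∷ []) ⟩
        x * X + n * X * x    ≤⟨ +-mono-≤ (*-monoʳ-≤ x X≤Y) (*-monoˡ-≤ x nX≤xY) ⟩
        x * Y + x * Y * x    ≡⟨ solve (x ∷ Y ∷ []) ⟩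
        x * (suc x * Y)      ∎

  [1+n]*n*x^[1+n]≤2x²*[1+x]^[1+n] : ∀ x n → suc n * n * x ^ suc n ≤ 2 * (x * x) * suc x ^ suc n
  [1+n]*n*x^[1+n]≤2x²*[1+x]^[1+n] x zero    = z≤n
  [1+n]*n*x^[1+n]≤2x²*[1+x]^[1+n] x (suc n) =
    step (x ^ suc n) (suc x ^ suc n) ([1+n]*n*x^[1+n]≤2x²*[1+x]^[1+n] x n) (n*x^n≤x*[1+x]^n x (suc n))
    where
      open ≤-Reasoning
      step : ∀ X Y → suc n * n * X ≤ 2 * (x * x) * Y → suc n * X ≤ x * Y →
             suc (suc n) * suc n * (x * X) ≤ 2 * (x * x) * (suc x * Y)
      step X Y quadratic linear = begin
        suc (suc n) * suc n * (x * X)                      ≡⟨ solve (n ∷ x ∷ X ∷ []) ⟩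
        x * (suc n * n * X) + 2 * x * (suc n * X)          ≤⟨ +-mono-≤ (*-monoʳ-≤ x quadratic) (*-monoʳ-≤ (2 * x) linear) ⟩
        x * (2 * (x * x) * Y) + 2 * x * (x * Y)            ≡⟨ solve (x ∷ Y ∷ []) ⟩
        2 * (x * x) * (suc x * Y)                          ∎

  9[1+m]x^[1+m]<[1+x]^[1+m] : ∀ x .{{_ : NonZero x}} m → 1 + 18 * x * x ≤ m → 9 * suc m * x ^ suc m < suc x ^ suc m
  9[1+m]x^[1+m]<[1+x]^[1+m] x m 1+18x²≤m = *-cancelˡ-< (2 * (x * x)) _ _
    (step (x ^ suc m) (suc x ^ suc m) (m^n>0 x (suc m)) ([1+n]*n*x^[1+n]≤2x²*[1+x]^[1+n] x m))
    where
      open ≤-Reasoning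
      step : ∀ X Y → 0 < X → suc m * m * X ≤ 2 * (x * x) * Y → 2 * (x * x) * (9 * suc m * X) < 2 * (x * x) * Y
      step X Y 0<X quadratic = begin-strict
        2 * (x * x) * (9 * suc m * X)                          ≡⟨ solve (x ∷ m ∷ X ∷ []) ⟩
        18 * x * x * (suc m * X)                               <⟨ m<m+n _ (<-≤-trans 0<X (m≤n*m X (suc m))) ⟩
        18 * x * x * (suc m * X) + suc m * X                   ≡⟨ solve (x ∷ m ∷ X ∷ []) ⟩
        suc m * (1 + 18 * x * x) * X                           ≤⟨ *-monoˡ-≤ X (*-monoʳ-≤ (suc m) 1+18x²≤m) ⟩
        suc m * m * X                                          ≤⟨ quadratic ⟩
        2 * (x * x) * Y                                        ∎

  [8+9d]^n<S[n]*[1+d]^n : ∀ d n → 2 + 18 * (8 + 9 * d) * (8 + 9 * d) ≤ n → (8 + 9 * d) ^ n < S n * suc d ^ n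
  [8+9d]^n<S[n]*[1+d]^n d (suc m) 2+18x²≤1+m = *-cancelˡ-< (9 * suc m) _ _ (begin-strict
    9 * suc m * x ^ suc m                  <⟨ 9[1+m]x^[1+m]<[1+x]^[1+m] x m (≤-pred 2+18x²≤1+m) ⟩
    suc x ^ suc m                          ≡⟨ cong (_^ suc m) 1+x≡9[1+d] ⟩
    (9 * suc d) ^ suc m                    ≡⟨ ^-distribʳ-* 9 (suc d) (suc m) ⟩
    9 * 9 ^ m * suc d ^ suc m              ≤⟨ *-monoˡ-≤ (suc d ^ suc m) (*-monoʳ-≤ 9 (9^n≤[1+n]*S[1+n] m)) ⟩
    9 * (suc m * S (suc m)) * suc d ^ suc m  ≡⟨ regroup (suc m) (S (suc m)) (suc d ^ suc m) ⟩
    9 * suc m * (S (suc m) * suc d ^ suc m)  ∎)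
    where
      open ≤-Reasoning
      x = 8 + 9 * d
      1+x≡9[1+d] : suc (8 + 9 * d) ≡ 9 * suc d
      1+x≡9[1+d] = solve (d ∷ [])
      regroup : ∀ a b c → 9 * (a * b) * c ≡ 9 * a * (b * c)
      regroup a b c = solve (a ∷ b ∷ c ∷ [])

module Limit where

  open import Data.Nat as ℕ using (ℕ; zero; suc)
  import Data.Nat.Properties as ℕₚ
  open import Data.Nat.Tactic.RingSolver using () renaming (solve to ℕ-solve)
  open import Data.List.Base using (_∷_; [])
  open import Data.Integer as ℤ using (+_; +[1+_]; -[1+_]; +0)
  import Data.Integer.Properties as ℤ
  open import Data.Nat.Coprimality using (1-coprimeTo) renaming (sym to coprime-sym)
  open import Data.Rational
  open import Data.Rational.Properties
  open import Data.Rational.Solver using (module +-*-Solver)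
  open import Data.Product.Base using (∃; _,_)
  open import Relation.Binary.PropositionalEquality
  open +-*-Solver
  open Growth using ([8+9d]^n<S[n]*[1+d]^n)
  open RatioBounds using (S≤9^n)

  ℕtoℚ≡mkℚ : ∀ a → ℕtoℚ a ≡ mkℚ (+ a) 0 (coprime-sym (1-coprimeTo a))
  ℕtoℚ≡mkℚ a = normalize-coprime (coprime-sym (1-coprimeTo a))

  ℕtoℚ-mono-≤ : ∀ {a b} → a ℕ.≤ b → ℕtoℚ a ≤ ℕtoℚ b
  ℕtoℚ-mono-≤ {a} {b} a≤b rewrite ℕtoℚ≡mkℚ a | ℕtoℚ≡mkℚ b =
    *≤* (subst₂ ℤ._≤_ (sym (ℤ.*-identityʳ (+ a))) (sym (ℤ.*-identityʳ (+ b))) (ℤ.+≤+ a≤b))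

  ℕtoℚ-mono-< : ∀ {a b} → a ℕ.< b → ℕtoℚ a < ℕtoℚ b
  ℕtoℚ-mono-< {a} {b} a<b rewrite ℕtoℚ≡mkℚ a | ℕtoℚ≡mkℚ b =
    *<* (subst₂ ℤ._<_ (sym (ℤ.*-identityʳ (+ a))) (sym (ℤ.*-identityʳ (+ b))) (ℤ.+<+ a<b))

  ℕtoℚ-homo-* : ∀ a b → ℕtoℚ (a ℕ.* b) ≡ ℕtoℚ a * ℕtoℚ b
  ℕtoℚ-homo-* a b rewrite ℕtoℚ≡mkℚ a | ℕtoℚ≡mkℚ b = cong (_/ 1) (ℤ.pos-* a b)

  ℕtoℚ-homo-+ : ∀ a b → ℕtoℚ (a ℕ.+ b) ≡ ℕtoℚ a + ℕtoℚ b
  ℕtoℚ-homo-+ a b rewrite ℕtoℚ≡mkℚ a | ℕtoℚ≡mkℚ b =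
    cong (_/ 1) (trans (ℤ.pos-+ a b) (sym (cong₂ ℤ._+_ (ℤ.*-identityʳ (+ a)) (ℤ.*-identityʳ (+ b)))))

  ℕtoℚ-homo-^ : ∀ a n → ℕtoℚ (a ℕ.^ n) ≡ ℕtoℚ a ^ℚ n
  ℕtoℚ-homo-^ a zero    = refl
  ℕtoℚ-homo-^ a (suc n) = trans (ℕtoℚ-homo-* a (a ℕ.^ n)) (cong (ℕtoℚ a *_) (ℕtoℚ-homo-^ a n))

  ℕtoℚ-nonNeg : ∀ a → 0ℚ ≤ ℕtoℚ a
  ℕtoℚ-nonNeg a = ℕtoℚ-mono-≤ {0} {a} ℕ.z≤n

  ^ℚ-distrib-* : ∀ a b n → (a * b) ^ℚ n ≡ a ^ℚ n * b ^ℚ n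
  ^ℚ-distrib-* a b zero    = refl
  ^ℚ-distrib-* a b (suc n) = trans (cong (a * b *_) (^ℚ-distrib-* a b n))
    (solve 4 (λ a b x y → (a :* b) :* (x :* y) := (a :* x) :* (b :* y)) refl a b (a ^ℚ n) (b ^ℚ n))

  *-nonNeg : ∀ {a b} → 0ℚ ≤ a → 0ℚ ≤ b → 0ℚ ≤ a * b
  *-nonNeg {a} {b} 0≤a 0≤b = subst (_≤ a * b) (*-zeroʳ a) (*-monoˡ-≤-nonNeg a {{nonNegative 0≤a}} 0≤b)

  ^ℚ-nonNeg : ∀ {a} n → 0ℚ ≤ a → 0ℚ ≤ a ^ℚ n
  ^ℚ-nonNeg zero    0≤a = ℕtoℚ-nonNeg 1
  ^ℚ-nonNeg (suc n) 0≤a = *-nonNeg 0≤a (^ℚ-nonNeg n 0≤a)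

  ^ℚ-monoˡ-≤ : ∀ {a b} n → 0ℚ ≤ a → a ≤ b → a ^ℚ n ≤ b ^ℚ n
  ^ℚ-monoˡ-≤ zero    0≤a a≤b = ≤-refl
  ^ℚ-monoˡ-≤ {a} {b} (suc n) 0≤a a≤b = ≤-trans
    (*-monoʳ-≤-nonNeg (a ^ℚ n) {{nonNegative (^ℚ-nonNeg n 0≤a)}} a≤b)
    (*-monoˡ-≤-nonNeg b {{nonNegative (≤-trans 0≤a a≤b)}} (^ℚ-monoˡ-≤ n 0≤a a≤b))

  ^ℚ-monoˡ-< : ∀ {a b} n → 0ℚ ≤ a → a < b → a ^ℚ suc n < b ^ℚ suc n
  ^ℚ-monoˡ-< zero    0≤a a<b = *-monoˡ-<-pos 1ℚ a<b
  ^ℚ-monoˡ-< {a} {b} (suc n) 0≤a a<b = ≤-<-trans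
    (*-monoʳ-≤-nonNeg (a ^ℚ suc n) {{nonNegative (^ℚ-nonNeg (suc n) 0≤a)}} (<⇒≤ a<b))
    (*-monoʳ-<-pos b {{positive (≤-<-trans 0≤a a<b)}} (^ℚ-monoˡ-< n 0≤a a<b))

  archimedean : ∀ ε → 0ℚ < ε → ∃ λ d → 1ℚ ≤ ε * ℕtoℚ (suc d)
  archimedean (mkℚ +0 _ _)       (*<* (ℤ.+<+ ()))
  archimedean (mkℚ -[1+ _ ] _ _) (*<* ())
  archimedean ε@(mkℚ +[1+ p ] d _) _ = d , (begin
    1ℚ                   ≡⟨ *-inverseˡ [1+d] ⟨
    1/ [1+d] * [1+d]     ≤⟨ *-monoʳ-≤-nonNeg [1+d] 1/[1+d]≤ε ⟩
    ε * [1+d]            ≡⟨ cong (ε *_) (ℕtoℚ≡mkℚ (suc d)) ⟨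
    ε * ℕtoℚ (suc d)     ∎)
    where
      open ≤-Reasoning
      [1+d] = mkℚ (+ suc d) 0 (coprime-sym (1-coprimeTo (suc d)))
      1/[1+d]≤ε : 1/ [1+d] ≤ ε
      1/[1+d]≤ε = *≤* (subst₂ ℤ._≤_ (ℤ.pos-* 1 (suc d)) (ℤ.pos-* (suc p) (suc d))
        (ℤ.+≤+ (ℕₚ.*-monoˡ-≤ (suc d) {1} {suc p} (ℕ.s≤s ℕ.z≤n))))

  [9-ε][1+d]≤8+9d : ∀ ε d → 1ℚ ≤ ε * ℕtoℚ (suc d) → (ℕtoℚ 9 - ε) * ℕtoℚ (suc d) ≤ ℕtoℚ (8 ℕ.+ 9 ℕ.* d)
  [9-ε][1+d]≤8+9d ε d 1≤ε[1+d] = begin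
    (ℕtoℚ 9 - ε) * D                  ≡⟨ solve 3 (λ n e D → (n :- e) :* D := n :* D :- e :* D) refl (ℕtoℚ 9) ε D ⟩
    ℕtoℚ 9 * D - ε * D                ≤⟨ +-monoʳ-≤ (ℕtoℚ 9 * D) (neg-antimono-≤ 1≤ε[1+d]) ⟩
    ℕtoℚ 9 * D - 1ℚ                   ≡⟨ cong (_- 1ℚ) (ℕtoℚ-homo-* 9 (suc d)) ⟨
    ℕtoℚ (9 ℕ.* suc d) - 1ℚ           ≡⟨ cong (λ m → ℕtoℚ m - 1ℚ) 9[1+d]≡[8+9d]+1 ⟩
    ℕtoℚ ((8 ℕ.+ 9 ℕ.* d) ℕ.+ 1) - 1ℚ  ≡⟨ cong (_- 1ℚ) (ℕtoℚ-homo-+ (8 ℕ.+ 9 ℕ.* d) 1) ⟩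
    ℕtoℚ (8 ℕ.+ 9 ℕ.* d) + 1ℚ - 1ℚ    ≡⟨ solve 2 (λ x o → x :+ o :- o := x) refl (ℕtoℚ (8 ℕ.+ 9 ℕ.* d)) 1ℚ ⟩
    ℕtoℚ (8 ℕ.+ 9 ℕ.* d)              ∎
    where
      open ≤-Reasoning
      D = ℕtoℚ (suc d)
      9[1+d]≡[8+9d]+1 : 9 ℕ.* suc d ≡ (8 ℕ.+ 9 ℕ.* d) ℕ.+ 1
      9[1+d]≡[8+9d]+1 = ℕ-solve (d ∷ [])

  S-lower-ℚ : ∀ ε → 0ℚ < ε → ∃ λ N → ∀ n → N ℕ.≤ n → 0ℚ ≤ ℕtoℚ 9 - ε → (ℕtoℚ 9 - ε) ^ℚ n < ℕtoℚ (S n)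
  S-lower-ℚ ε 0<ε with archimedean ε 0<ε
  ... | d , 1≤ε[1+d] = 2 ℕ.+ 18 ℕ.* x ℕ.* x , λ n N≤n 0≤9-ε →
    *-cancelʳ-<-nonNeg (D ^ℚ n) {{nonNegative (^ℚ-nonNeg n (ℕtoℚ-nonNeg (suc d)))}} (begin-strict
      (ℕtoℚ 9 - ε) ^ℚ n * D ^ℚ n      ≡⟨ ^ℚ-distrib-* (ℕtoℚ 9 - ε) D n ⟨
      ((ℕtoℚ 9 - ε) * D) ^ℚ n         ≤⟨ ^ℚ-monoˡ-≤ n (*-nonNeg 0≤9-ε (ℕtoℚ-nonNeg (suc d))) ([9-ε][1+d]≤8+9d ε d 1≤ε[1+d]) ⟩
      ℕtoℚ x ^ℚ n                     ≡⟨ ℕtoℚ-homo-^ x n ⟨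
      ℕtoℚ (x ℕ.^ n)                  <⟨ ℕtoℚ-mono-< ([8+9d]^n<S[n]*[1+d]^n d n N≤n) ⟩
      ℕtoℚ (S n ℕ.* suc d ℕ.^ n)      ≡⟨ ℕtoℚ-homo-* (S n) (suc d ℕ.^ n) ⟩
      ℕtoℚ (S n) * ℕtoℚ (suc d ℕ.^ n) ≡⟨ cong (ℕtoℚ (S n) *_) (ℕtoℚ-homo-^ (suc d) n) ⟩
      ℕtoℚ (S n) * D ^ℚ n             ∎)
    where
      open ≤-Reasoning
      x = 8 ℕ.+ 9 ℕ.* d
      D = ℕtoℚ (suc d)

  S-upper-ℚ : ∀ ε → 0ℚ < ε → ∀ n → 1 ℕ.≤ n → ℕtoℚ (S n) < (ℕtoℚ 9 + ε) ^ℚ n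
  S-upper-ℚ ε 0<ε (suc m) _ = begin-strict
    ℕtoℚ (S (suc m))        ≤⟨ ℕtoℚ-mono-≤ (S≤9^n (suc m)) ⟩
    ℕtoℚ (9 ℕ.^ suc m)      ≡⟨ ℕtoℚ-homo-^ 9 (suc m) ⟩
    ℕtoℚ 9 ^ℚ suc m         <⟨ ^ℚ-monoˡ-< m (ℕtoℚ-nonNeg 9) 9<9+ε ⟩
    (ℕtoℚ 9 + ε) ^ℚ suc m   ∎
    where
      open ≤-Reasoning
      9<9+ε : ℕtoℚ 9 < ℕtoℚ 9 + ε
      9<9+ε = subst (_< ℕtoℚ 9 + ε) (+-identityʳ (ℕtoℚ 9)) (+-monoʳ-< (ℕtoℚ 9) 0<ε)

open import Data.Nat using (ℕ; suc; _≥_; _^_) renaming (_<_ to _<ℕ_)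
open import Data.Product using (_×_; ∃; _,_; proj₁; proj₂)
open import Data.Sum using (_⊎_; inj₁; inj₂)
open import Data.Rational using (ℚ; 0ℚ; _<_; _-_; _+_; _<?_)
open import Data.Rational.Properties using (≮⇒≥)
open import Relation.Nullary using (Dec; yes; no)
open Growth using (S-root-increasing)
open Limit using (S-lower-ℚ; S-upper-ℚ)

corollary4p3 : ((n : ℕ) → n ≥ 1 → S n ^ suc n <ℕ S (suc n) ^ n)
    × ((ε : ℚ) → 0ℚ < ε → ∃ λ N → (n : ℕ) → n ≥ 1 → n ≥ N →
        ((ℕtoℚ 9 - ε < 0ℚ) ⊎ ((ℕtoℚ 9 - ε) ^ℚ n < ℕtoℚ (S n))) × (ℕtoℚ (S n) < (ℕtoℚ 9 + ε) ^ℚ n))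
corollary4p3 = root-increasing , root-limit
  where
    root-increasing : (n : ℕ) → n ≥ 1 → S n ^ suc n <ℕ S (suc n) ^ n
    root-increasing (suc m) _ = S-root-increasing m
    root-limit : (ε : ℚ) → 0ℚ < ε → ∃ λ N → (n : ℕ) → n ≥ 1 → n ≥ N →
      ((ℕtoℚ 9 - ε < 0ℚ) ⊎ ((ℕtoℚ 9 - ε) ^ℚ n < ℕtoℚ (S n))) × (ℕtoℚ (S n) < (ℕtoℚ 9 + ε) ^ℚ n)
    root-limit ε 0<ε = N , λ n n≥1 n≥N → lower-or-negative n n≥N (ℕtoℚ 9 - ε <? 0ℚ) , S-upper-ℚ ε 0<ε n n≥1
      where
        N = proj₁ (S-lower-ℚ ε 0<ε)
        lower-or-negative : ∀ n → n ≥ N → Dec (ℕtoℚ 9 - ε < 0ℚ) → (ℕtoℚ 9 - ε < 0ℚ) ⊎ ((ℕtoℚ 9 - ε) ^ℚ n < ℕtoℚ (S n))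
        lower-or-negative n n≥N (yes 9-ε<0) = inj₁ 9-ε<0
        lower-or-negative n n≥N (no 9-ε≮0)  = inj₂ (proj₂ (S-lower-ℚ ε 0<ε) n n≥N (≮⇒≥ 9-ε≮0))
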